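{- Let $T$ be a tree and $T_L$ the tree obtained from $T$ by removing all leaves of $T$. Then $|E_{fix}(T)|\ge 2^{r/2}$, where $r$ is the number of inner nodes (nodes of degree at least $2$) of $T_L$.
   Context: For a tree $T=(V,E)$, $E_{fix}(T)$ is the set of all $F\subseteq E$ with $2deg_F(v)\le deg(v)$ for every $v\in V$, where $deg_F(v)$ is the number of edges of $F$ incident to $v$ and $deg(v)$ is the degree of $v$ in $T$. -}

module Defs where

open import Data.Nat using (ℕ; zero; suc; _+_; _*_; _≤_; _≤?_; _≟_)
open import Data.Nat.Properties using ()
open import Data.Bool using (Bool; true; false)
open import Data.Fin using (Fin)
open import Data.Fin.Properties using (all?)
open import Data.Product using (_×_; _,_; proj₁; proj₂; ∃)
open import Data.Sum using (_⊎_)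
open import Data.Vec using (Vec; []; _∷_; lookup; replicate)
open import Data.List as L using (List; length; filter; allFin)
open import Data.List.Relation.Unary.Unique.Propositional using (Unique)
open import Relation.Nullary using (¬_; Dec; yes; no)
open import Relation.Binary.PropositionalEquality using (_≡_; _≢_; refl)
import Data.Fin as F

-- A (finite multi)graph on vertex set Fin n with m edges listed in a vector.
-- An edge is an ordered pair of vertices; it is read as unordered.
Edge : ℕ → Set
Edge n = Fin n × Fin n

incident? : ∀ {n} (v : Fin n) (e : Edge n) → Bool
incident? v (a , b) with a F.≟ v | b F.≟ v
... | yes _ | _     = true
... | no _  | yes _ = true
... | no _  | no _  = false

degSub : ∀ {n m} → Vec (Edge n) m → Vec Bool m → Fin n → ℕ
degSub [] [] v = 0
degSub (e ∷ E) (true ∷ S) v with incident? v e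
... | true  = suc (degSub E S v)
... | false = degSub E S v
degSub (e ∷ E) (false ∷ S) v = degSub E S v

deg : ∀ {n m} → Vec (Edge n) m → Fin n → ℕ
deg {m = m} E v = degSub E (replicate m true) v

data Walk {n m} (E : Vec (Edge n) m) : Fin n → Fin n → List (Fin m) → Set where
  nil  : ∀ {v} → Walk E v v L.[]
  fwd  : ∀ {u w v is} (i : Fin m) → lookup E i ≡ (u , w) → Walk E w v is → Walk E u v (i L.∷ is)
  bwd  : ∀ {u w v is} (i : Fin m) → lookup E i ≡ (w , u) → Walk E w v is → Walk E u v (i L.∷ is)

Connected : ∀ {n m} → Vec (Edge n) m → Set
Connected {n} E = ∀ (u v : Fin n) → ∃ λ is → Walk E u v is

-- Tree: nonempty, simple (no loops, no parallel edges), connected and acyclic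
-- (no nonempty closed walk using pairwise distinct edges, i.e. no cycle).
record IsTree {n m} (E : Vec (Edge n) m) : Set where
  field
    nonempty   : 1 ≤ n
    noLoop     : ∀ i → proj₁ (lookup E i) ≢ proj₂ (lookup E i)
    noParallel : ∀ i j → i ≢ j →
                   lookup E i ≢ lookup E j × lookup E i ≢ (proj₂ (lookup E j) , proj₁ (lookup E j))
    connected  : Connected E
    acyclic    : ∀ v (is : List (Fin m)) → Walk E v v is → Unique is → is ≡ L.[]

-- F ∈ E_fix(T)  iff  2 deg_F(v) ≤ deg(v) for every vertex v.
IsFix : ∀ {n m} → Vec (Edge n) m → Vec Bool m → Set
IsFix E S = ∀ v → 2 * degSub E S v ≤ deg E v

isFix? : ∀ {n m} (E : Vec (Edge n) m) (S : Vec Bool m) → Dec (IsFix E S)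
isFix? E S = all? (λ v → 2 * degSub E S v ≤? deg E v)

allSubsets : ∀ m → List (Vec Bool m)
allSubsets zero = [] L.∷ L.[]
allSubsets (suc m) = L.map (true ∷_) (allSubsets m) L.++ L.map (false ∷_) (allSubsets m)

numFix : ∀ {n m} → Vec (Edge n) m → ℕ
numFix E = length (filter (isFix? E) (allSubsets _))

isLeaf? : ∀ {n m} (E : Vec (Edge n) m) (v : Fin n) → Bool
isLeaf? E v with deg E v ≟ 1
... | yes _ = true
... | no _  = false

-- Edge mask of T_L: edges of T whose both endpoints are not leaves of T.
keepL : ∀ {n m} → Vec (Edge n) m → Vec Bool m
keepL E = Data.Vec.map keep E
  where
  keep : _ → Bool
  keep (a , b) with isLeaf? E a | isLeaf? E b
  ... | false | false = true
  ... | _     | _     = false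

InnerL : ∀ {n m} → Vec (Edge n) m → Fin n → Set
InnerL E v = (isLeaf? E v ≡ false) × (2 ≤ degSub E (keepL E) v)

innerL? : ∀ {n m} (E : Vec (Edge n) m) (v : Fin n) → Dec (InnerL E v)
innerL? E v with isLeaf? E v | 2 ≤? degSub E (keepL E) v
... | false | yes p = yes (refl , p)
... | false | no ¬p = no (λ x → ¬p (proj₂ x))
... | true  | _     = no (λ x → true≢false (proj₁ x))
  where
  true≢false : true ≢ false
  true≢false ()

innerCount : ∀ {n m} → Vec (Edge n) m → ℕ
innerCount {n} E = length (filter (innerL? E) (allFin n))

{-# OPTIONS --safe #-}
-- Call a vertex of a forest H a branch vertex if its H-degree is at least 2.  Peeling off
-- leaves one at a time shows that every forest H contains two matchings M₁, M₂ with
-- |M₁| + |M₂| ≥ #branch vertices, such that every vertex of H-degree ≤ 1 is missed by one of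
-- them: re-adding a pendant edge ab at the leaf a creates at most one new branch vertex, b, and
-- only if b was a leaf, in which case ab can be added to the matching that misses b.
-- Apply this to H = T_L, whose branch vertices are the r inner nodes.  Every subset of a
-- matching of T_L lies in E_fix(T): it meets each vertex at most once, and the endpoints of
-- T_L-edges have degree ≥ 2 in T.  Hence |E_fix(T)|² ≥ 2^|M₁| · 2^|M₂| ≥ 2^r.

module Submission where

open import Defs
open import Data.Bool using (Bool; true; false; if_then_else_)
open import Data.Empty using (⊥; ⊥-elim)
open import Data.Fin as F using (Fin)
open import Data.Fin.Properties using (any?; injective⇒≤)
open import Data.Fin.Subset using (Subset; inside; outside; _∈_; _∉_; _⊆_; ∣_∣; _∪_; _-_; ⁅_⁆)
  renaming (⊥ to ∅)
open import Data.Fin.Subset.Properties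
  using (drop-∷-⊆; drop-not-there; in⊆in; out⊆; ⊆-refl; ⊆-trans; ⊥⊆; ⊆⊤; ∣p∣≤n; p─⊥≡p; ∪-identityʳ;
         p─q⊆p; x∈⁅y⁆⇒x≡y; x∈p∪q⁻; x∈p⇒∣p-x∣<∣p∣)
  renaming (_∈?_ to _∈ˢ?_)
open import Data.List as L using (List; []; _∷_; length; filter; allFin)
open import Data.List.Properties using (length-++; filter-++; filter-none)
open import Data.List.Membership.Propositional using () renaming (_∈_ to _∈ₗ_; _∉_ to _∉ₗ_)
open import Data.List.Membership.Propositional.Properties using (∈-lookup)
open import Data.List.Relation.Unary.All as All using (All; []; _∷_)
open import Data.List.Relation.Unary.All.Properties using (¬Any⇒All¬)
open import Data.List.Relation.Unary.Any using (here; there)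
open import Data.List.Relation.Unary.AllPairs using ([]; _∷_)
open import Data.List.Relation.Unary.Unique.Propositional using (Unique)
open import Data.List.Relation.Unary.Unique.Propositional.Properties using (allFin⁺; take⁺)
open import Data.Nat
open import Data.Nat.Properties
open import Algebra.Properties.CommutativeSemigroup +-commutativeSemigroup using (x∙yz≈y∙xz)
open import Data.Product using (_×_; _,_; proj₁; proj₂; ∃)
open import Data.Sum using (_⊎_; inj₁; inj₂; [_,_])
import Data.Sum as Sum
open import Data.Vec using (Vec; []; _∷_; lookup; here; there)
open import Data.Vec.Properties using (lookup-map; []=⇒lookup)
open import Function using (_∘_; id; case_of_)
open import Function.Definitions using (Injective)
open import Level using (0ℓ)
open import Relation.Binary.PropositionalEquality using (_≡_; _≢_; refl; sym; trans; cong; cong₂; subst; ≢-sym; module ≡-Reasoning)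
open import Relation.Nullary using (¬_; yes; no; contradiction)
open import Relation.Unary using (Pred; Decidable)

module _ {A : Set} {P Q : Pred A 0ℓ} (P? : Decidable P) (Q? : Decidable Q) where

  length-filter-mono : ∀ {xs} → All (λ x → P x → Q x) xs →
                       length (filter P? xs) ≤ length (filter Q? xs)
  length-filter-mono {[]}     []             = z≤n
  length-filter-mono {x ∷ xs} (P⇒Q ∷ P⇒Q*) with P? x | Q? x
  ... | yes _  | yes _ = s≤s (length-filter-mono P⇒Q*)
  ... | yes px | no ¬q = contradiction (P⇒Q px) ¬q
  ... | no _   | yes _ = m≤n⇒m≤1+n (length-filter-mono P⇒Q*)
  ... | no _   | no _  = length-filter-mono P⇒Q*

  length-filter-≤-suc : ∀ {b xs} → Unique xs → (∀ {x} → P x → Q x ⊎ x ≡ b) →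
                        length (filter P? xs) ≤ suc (length (filter Q? xs))
  length-filter-≤-suc {xs = []}     []           _     = z≤n
  length-filter-≤-suc {xs = x ∷ xs} (x∉xs ∷ uxs) P⇒Q⊎b with P? x | Q? x
  ... | yes _  | yes _ = s≤s (length-filter-≤-suc uxs P⇒Q⊎b)
  ... | no _   | yes _ = m≤n⇒m≤1+n (length-filter-≤-suc uxs P⇒Q⊎b)
  ... | no _   | no _  = length-filter-≤-suc uxs P⇒Q⊎b
  ... | yes px | no ¬q with P⇒Q⊎b px
  ...   | inj₁ q    = contradiction q ¬q
  ...   | inj₂ refl = s≤s (length-filter-mono (All.map P⇒Q-away-from-x x∉xs))
    where
    P⇒Q-away-from-x : ∀ {y} → x ≢ y → P y → Q y
    P⇒Q-away-from-x x≢y py = [ id , (λ y≡x → contradiction (sym y≡x) x≢y) ] (P⇒Q⊎b py)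

module _ {A B : Set} {P : Pred B 0ℓ} (P? : Decidable P) (f : A → B) where

  length-filter-map : ∀ xs → length (filter P? (L.map f xs)) ≡ length (filter (P? ∘ f) xs)
  length-filter-map []       = refl
  length-filter-map (x ∷ xs) with P? (f x)
  ... | yes _ = cong suc (length-filter-map xs)
  ... | no _  = length-filter-map xs

lookup-injective : ∀ {A : Set} {xs : List A} → Unique xs → Injective _≡_ _≡_ (L.lookup xs)
lookup-injective (_ ∷ _) {F.zero} {F.zero} _ = refl
lookup-injective (x∉xs ∷ _) {F.zero} {F.suc j} x≡xs[j] = contradiction x≡xs[j] (All.lookup x∉xs (∈-lookup j))
lookup-injective (x∉xs ∷ _) {F.suc i} {F.zero} xs[i]≡x = contradiction (sym xs[i]≡x) (All.lookup x∉xs (∈-lookup i))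
lookup-injective (_ ∷ uxs) {F.suc i} {F.suc j} eq = cong F.suc (lookup-injective uxs eq)

unique⇒length≤ : ∀ {n} {xs : List (Fin n)} → Unique xs → length xs ≤ n
unique⇒length≤ uxs = injective⇒≤ (lookup-injective uxs)

-- Subsets; the edge masks Vec Bool m of Defs are exactly Subset m, with inside = true

x∉p-x : ∀ {m} (p : Subset m) x → x ∉ p - x
x∉p-x (_ ∷ p) F.zero    ()
x∉p-x (_ ∷ p) (F.suc x) (there x∈p-x) = x∉p-x p x x∈p-x

∣p∪⁅x⁆∣≡1+∣p∣ : ∀ {m} {p : Subset m} {x} → x ∉ p → ∣ p ∪ ⁅ x ⁆ ∣ ≡ suc ∣ p ∣
∣p∪⁅x⁆∣≡1+∣p∣ {p = inside  ∷ p} {F.zero}  x∉p = contradiction here x∉p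
∣p∪⁅x⁆∣≡1+∣p∣ {p = outside ∷ p} {F.zero}  _   = cong (suc ∘ ∣_∣) (∪-identityʳ p)
∣p∪⁅x⁆∣≡1+∣p∣ {p = inside  ∷ p} {F.suc x} x∉p = cong suc (∣p∪⁅x⁆∣≡1+∣p∣ (drop-not-there x∉p))
∣p∪⁅x⁆∣≡1+∣p∣ {p = outside ∷ p} {F.suc x} x∉p = ∣p∪⁅x⁆∣≡1+∣p∣ (drop-not-there x∉p)

subsets-count : ∀ {m} {P : Pred (Subset m) 0ℓ} (P? : Decidable P) (M : Subset m) →
                (∀ {S} → S ⊆ M → P S) → 2 ^ ∣ M ∣ ≤ length (filter P? (allSubsets m))
subsets-count {zero} P? [] all-P with P? []
... | yes _  = ≤-refl
... | no ¬P = contradiction (all-P ⊆-refl) ¬P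
subsets-count {suc m} {P} P? (s ∷ M) all-P = begin
  2 ^ ∣ s ∷ M ∣               ≤⟨ bound s all-P ⟩
  count inside + count outside ≡⟨ sym split ⟩
  length (filter P? (allSubsets (suc m))) ∎
  where
  open ≤-Reasoning

  xs : List (Subset m)
  xs = allSubsets m

  count : Bool → ℕ
  count t = length (filter (P? ∘ (t ∷_)) xs)

  split : length (filter P? (allSubsets (suc m))) ≡ count inside + count outside
  split = begin-equality
    length (filter P? (L.map (inside ∷_) xs L.++ L.map (outside ∷_) xs))
      ≡⟨ cong length (filter-++ P? (L.map (inside ∷_) xs) _) ⟩
    length (filter P? (L.map (inside ∷_) xs) L.++ filter P? (L.map (outside ∷_) xs))
      ≡⟨ length-++ (filter P? (L.map (inside ∷_) xs)) ⟩
    length (filter P? (L.map (inside ∷_) xs)) + length (filter P? (L.map (outside ∷_) xs))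
      ≡⟨ cong₂ _+_ (length-filter-map P? (inside ∷_) xs) (length-filter-map P? (outside ∷_) xs) ⟩
    count inside + count outside ∎

  with-outside : ∀ {s} → (∀ {S} → S ⊆ s ∷ M → P S) → 2 ^ ∣ M ∣ ≤ count outside
  with-outside all-P = subsets-count (P? ∘ (outside ∷_)) M (all-P ∘ out⊆)

  bound : ∀ s → (∀ {S} → S ⊆ s ∷ M → P S) → 2 ^ ∣ s ∷ M ∣ ≤ count inside + count outside
  bound inside  all-P = +-mono-≤ (subsets-count (P? ∘ (inside ∷_)) M (all-P ∘ in⊆in))
                                 (≤-trans (≤-reflexive (+-identityʳ _)) (with-outside all-P))
  bound outside all-P = ≤-trans (with-outside all-P) (m≤n+m _ _)

module _ {n : ℕ} where

  incidence : Fin n → Edge n → ℕ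
  incidence v e = if incident? v e then 1 else 0

  incidence≤1 : ∀ v e → incidence v e ≤ 1
  incidence≤1 v e with incident? v e
  ... | true  = ≤-refl
  ... | false = z≤n

  incidence-true : ∀ {v e} → incident? v e ≡ true → incidence v e ≡ 1
  incidence-true = cong (if_then 1 else 0)

  incidence-false : ∀ {v e} → incident? v e ≡ false → incidence v e ≡ 0
  incidence-false = cong (if_then 1 else 0)

  incident-proj₁ : ∀ (e : Edge n) → incident? (proj₁ e) e ≡ true
  incident-proj₁ (a , b) with a F.≟ a
  ... | yes _   = refl
  ... | no a≢a = contradiction refl a≢a

  incident-proj₂ : ∀ (e : Edge n) → incident? (proj₂ e) e ≡ true
  incident-proj₂ (a , b) with a F.≟ b | b F.≟ b
  ... | yes _ | _      = refl
  ... | no _  | yes _  = refl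
  ... | no _  | no b≢b = contradiction refl b≢b

  incident⇒endpoint : ∀ {v : Fin n} (e : Edge n) → incident? v e ≡ true → v ≡ proj₁ e ⊎ v ≡ proj₂ e
  incident⇒endpoint {v} (a , b) inc with a F.≟ v | b F.≟ v
  ... | yes a≡v | _       = inj₁ (sym a≡v)
  ... | no _    | yes b≡v = inj₂ (sym b≡v)
  incident⇒endpoint (a , b) () | no _ | no _

  ¬endpoint⇒¬incident : ∀ {v a b : Fin n} → v ≢ a → v ≢ b → incident? v (a , b) ≡ false
  ¬endpoint⇒¬incident {v} {a} {b} v≢a v≢b with a F.≟ v | b F.≟ v
  ... | yes a≡v | _       = contradiction (sym a≡v) v≢a
  ... | no _    | yes b≡v = contradiction (sym b≡v) v≢b
  ... | no _    | no _    = refl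

  degSub-inside : ∀ {k} e (E : Vec (Edge n) k) S v →
                  degSub (e ∷ E) (inside ∷ S) v ≡ incidence v e + degSub E S v
  degSub-inside e E S v with incident? v e
  ... | true  = refl
  ... | false = refl

  degSub-inside-shift : ∀ {k} e (E : Vec (Edge n) k) {p q c} v →
                        degSub E q v ≡ c + degSub E p v →
                        degSub (e ∷ E) (inside ∷ q) v ≡ c + degSub (e ∷ E) (inside ∷ p) v
  degSub-inside-shift e E {p} {q} {c} v eq = begin
    degSub (e ∷ E) (inside ∷ q) v      ≡⟨ degSub-inside e E q v ⟩
    incidence v e + degSub E q v       ≡⟨ cong (incidence v e +_) eq ⟩
    incidence v e + (c + degSub E p v) ≡⟨ x∙yz≈y∙xz (incidence v e) c _ ⟩
    c + (incidence v e + degSub E p v) ≡⟨ cong (c +_) (degSub-inside e E p v) ⟨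
    c + degSub (e ∷ E) (inside ∷ p) v  ∎
    where open ≡-Reasoning

  degSub-∅ : ∀ {k} (E : Vec (Edge n) k) v → degSub E ∅ v ≡ 0
  degSub-∅ []      v = refl
  degSub-∅ (e ∷ E) v = degSub-∅ E v

  degSub-mono : ∀ {k} (E : Vec (Edge n) k) {p q} → p ⊆ q → ∀ v → degSub E p v ≤ degSub E q v
  degSub-mono []      {[]}          {[]}          _   v = z≤n
  degSub-mono (e ∷ E) {outside ∷ p} {outside ∷ q} p⊆q v = degSub-mono E (drop-∷-⊆ p⊆q) v
  degSub-mono (e ∷ E) {outside ∷ p} {inside ∷ q}  p⊆q v rewrite degSub-inside e E q v =
    ≤-trans (degSub-mono E (drop-∷-⊆ p⊆q) v) (m≤n+m _ _)
  degSub-mono (e ∷ E) {inside ∷ p}  {outside ∷ q} p⊆q v with p⊆q here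
  ... | ()
  degSub-mono (e ∷ E) {inside ∷ p}  {inside ∷ q}  p⊆q v
    rewrite degSub-inside e E p v | degSub-inside e E q v =
    +-monoʳ-≤ (incidence v e) (degSub-mono E (drop-∷-⊆ p⊆q) v)

  degSub-remove : ∀ {k} (E : Vec (Edge n) k) {p j} → j ∈ p → ∀ v →
                  degSub E p v ≡ incidence v (lookup E j) + degSub E (p - j) v
  degSub-remove (e ∷ E) {inside ∷ p}  here v =
    trans (degSub-inside e E p v) (cong (λ q → incidence v e + degSub E q v) (sym (p─⊥≡p p)))
  degSub-remove (e ∷ E) {outside ∷ p} (there j∈p) v = degSub-remove E j∈p v
  degSub-remove (e ∷ E) {inside ∷ p}  (there j∈p) v = degSub-inside-shift e E v (degSub-remove E j∈p v)

  degSub-∪⁅⁆ : ∀ {k} (E : Vec (Edge n) k) {p j} → j ∉ p → ∀ v →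
               degSub E (p ∪ ⁅ j ⁆) v ≡ incidence v (lookup E j) + degSub E p v
  degSub-∪⁅⁆ (e ∷ E) {inside ∷ p}  {F.zero}  j∉p v = contradiction here j∉p
  degSub-∪⁅⁆ (e ∷ E) {outside ∷ p} {F.zero}  _   v =
    trans (degSub-inside e E (p ∪ ∅) v) (cong (λ q → incidence v e + degSub E q v) (∪-identityʳ p))
  degSub-∪⁅⁆ (e ∷ E) {outside ∷ p} {F.suc j} j∉p v = degSub-∪⁅⁆ E (drop-not-there j∉p) v
  degSub-∪⁅⁆ (e ∷ E) {inside ∷ p}  {F.suc j} j∉p v =
    degSub-inside-shift e E v (degSub-∪⁅⁆ E (drop-not-there j∉p) v)

  incident-edge : ∀ {k} (E : Vec (Edge n) k) {p} v → 1 ≤ degSub E p v →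
                  ∃ λ j → j ∈ p × incident? v (lookup E j) ≡ true
  incident-edge []      {[]}          v ()
  incident-edge (e ∷ E) {outside ∷ p} v deg≥1 with incident-edge E v deg≥1
  ... | j , j∈p , inc = F.suc j , there j∈p , inc
  incident-edge (e ∷ E) {inside ∷ p}  v deg≥1 with incident? v e in inc
  ... | true  = F.zero , here , inc
  ... | false with incident-edge E v deg≥1
  ...   | j , j∈p , inc′ = F.suc j , there j∈p , inc′

  other-incident-edge : ∀ {k} (E : Vec (Edge n) k) {p} v h → 2 ≤ degSub E p v →
                        ∃ λ j → j ≢ h × j ∈ p × incident? v (lookup E j) ≡ true
  other-incident-edge E {p} v h deg≥2 with h ∈ˢ? p
  ... | no h∉p =
    let j , j∈p , inc = incident-edge E v (≤-trans (s≤s z≤n) deg≥2)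
    in j , (λ j≡h → h∉p (subst (_∈ p) j≡h j∈p)) , j∈p , inc
  ... | yes h∈p =
    let j , j∈p-h , inc = incident-edge E v deg-without-h≥1
    in j , (λ j≡h → x∉p-x p h (subst (_∈ p - h) j≡h j∈p-h)) , p─q⊆p p ⁅ h ⁆ j∈p-h , inc
    where
    open ≤-Reasoning
    deg-without-h≥1 : 1 ≤ degSub E (p - h) v
    deg-without-h≥1 = ≤-pred (begin
      2                                                  ≤⟨ deg≥2 ⟩
      degSub E p v                                       ≡⟨ degSub-remove E h∈p v ⟩
      incidence v (lookup E h) + degSub E (p - h) v      ≤⟨ +-monoˡ-≤ _ (incidence≤1 v (lookup E h)) ⟩
      1 + degSub E (p - h) v                             ∎)

  incident⇒degSub≥1 : ∀ {k} (E : Vec (Edge n) k) {p j v} → j ∈ p →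
                      incident? v (lookup E j) ≡ true → 1 ≤ degSub E p v
  incident⇒degSub≥1 E {j = j} {v} j∈p inc rewrite degSub-remove E j∈p v | inc = s≤s z≤n

module _ {n m : ℕ} (E : Vec (Edge n) m) where

  Joins : Fin m → Fin n → Fin n → Set
  Joins j u w = lookup E j ≡ (u , w) ⊎ lookup E j ≡ (w , u)

  joins-sym : ∀ {j u w} → Joins j u w → Joins j w u
  joins-sym = Sum.swap

  joins⇒incident : ∀ {j u w} → Joins j u w → incident? u (lookup E j) ≡ true
  joins⇒incident {u = u} {w} (inj₁ eq) = subst (λ e → incident? u e ≡ true) (sym eq) (incident-proj₁ (u , w))
  joins⇒incident {u = u} {w} (inj₂ eq) = subst (λ e → incident? u e ≡ true) (sym eq) (incident-proj₂ (w , u))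

  incident⇒joins : ∀ {v} j → incident? v (lookup E j) ≡ true → ∃ λ w → Joins j v w
  incident⇒joins j inc with incident⇒endpoint (lookup E j) inc
  ... | inj₁ refl = proj₂ (lookup E j) , inj₁ refl
  ... | inj₂ refl = proj₁ (lookup E j) , inj₂ refl

  joins-cases : ∀ {j a b} → Joins j a b → ∀ x → x ≡ a ⊎ x ≡ b ⊎ incident? x (lookup E j) ≡ false
  joins-cases {j} {a} {b} j-ab x with x F.≟ a | x F.≟ b
  ... | yes x≡a | _       = inj₁ x≡a
  ... | no _    | yes x≡b = inj₂ (inj₁ x≡b)
  ... | no x≢a  | no x≢b  = inj₂ (inj₂ (Sum.[ off x≢a x≢b , off x≢b x≢a ] j-ab))
    where
    off : ∀ {c d} → x ≢ c → x ≢ d → lookup E j ≡ (c , d) → incident? x (lookup E j) ≡ false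
    off x≢c x≢d eq = subst (λ e → incident? x e ≡ false) (sym eq) (¬endpoint⇒¬incident x≢c x≢d)

  joins⇒endpoint : ∀ {j a b x} → Joins j a b → incident? x (lookup E j) ≡ true → x ≡ a ⊎ x ≡ b
  joins⇒endpoint {x = x} j-ab inc with joins-cases j-ab x
  ... | inj₁ x≡a         = inj₁ x≡a
  ... | inj₂ (inj₁ x≡b)  = inj₂ x≡b
  ... | inj₂ (inj₂ ¬inc) = case trans (sym inc) ¬inc of λ ()

  step : ∀ {j u w x is} → Joins j u w → Walk E w x is → Walk E u x (j ∷ is)
  step {j} (inj₁ eq) = fwd j eq
  step {j} (inj₂ eq) = bwd j eq

  vertices : ∀ {u v is} → Walk E u v is → List (Fin n)
  vertices {u} nil         = u ∷ []
  vertices {u} (fwd _ _ W) = u ∷ vertices W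
  vertices {u} (bwd _ _ W) = u ∷ vertices W

  vertices-step : ∀ {j u w x is} (j-uw : Joins j u w) (W : Walk E w x is) →
                  vertices (step j-uw W) ≡ u ∷ vertices W
  vertices-step (inj₁ _) W = refl
  vertices-step (inj₂ _) W = refl

  start∈vertices : ∀ {u v is} (W : Walk E u v is) → u ∈ₗ vertices W
  start∈vertices nil         = here refl
  start∈vertices (fwd _ _ W) = here refl
  start∈vertices (bwd _ _ W) = here refl

  endpoint∈step : ∀ {j u w x v is} → Joins j u w → (W : Walk E w v is) →
                  incident? x (lookup E j) ≡ true → x ∈ₗ u ∷ vertices W
  endpoint∈step j-uw W inc with joins⇒endpoint j-uw inc
  ... | inj₁ x≡u  = here x≡u
  ... | inj₂ refl = there (start∈vertices W)

  endpoint∈vertices : ∀ {u v is j x} (W : Walk E u v is) → j ∈ₗ is →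
                      incident? x (lookup E j) ≡ true → x ∈ₗ vertices W
  endpoint∈vertices (fwd _ eq W) (here refl) = endpoint∈step (inj₁ eq) W
  endpoint∈vertices (bwd _ eq W) (here refl) = endpoint∈step (inj₂ eq) W
  endpoint∈vertices (fwd _ _ W) (there j∈is) = there ∘ endpoint∈vertices W j∈is
  endpoint∈vertices (bwd _ _ W) (there j∈is) = there ∘ endpoint∈vertices W j∈is

  prefix : ∀ {u v is x} (W : Walk E u v is) → x ∈ₗ vertices W → ∃ λ k → Walk E u x (L.take k is)
  prefix nil         (here refl) = 0 , nil
  prefix (fwd _ _ W) (here refl) = 0 , nil
  prefix (bwd _ _ W) (here refl) = 0 , nil
  prefix (fwd j eq W) (there x∈W) = let k , W₁ = prefix W x∈W in suc k , fwd j eq W₁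
  prefix (bwd j eq W) (there x∈W) = let k , W₁ = prefix W x∈W in suc k , bwd j eq W₁

-- Leaves of forests

Acyclic : ∀ {n m} → Vec (Edge n) m → Set
Acyclic {n} {m} E = ∀ (v : Fin n) (is : List (Fin m)) → Walk E v v is → Unique is → is ≡ []

module _ {n m} {E : Vec (Edge n) m} (acyclic : Acyclic E) where

  neighbour-off-walk : ∀ {j v w x is} → Joins E j w v → (W : Walk E v x is) → Unique (j ∷ is) →
                       w ∉ₗ vertices E W
  neighbour-off-walk {j} {w = w} {is = is} j-wv W ujis w∈W with prefix E W w∈W
  ... | k , W₁ = case acyclic w (j ∷ L.take k is) (step E j-wv W₁) (take⁺ (suc k) ujis) of λ ()

  module _ (H : Subset m) (no-leaf : ∀ v → degSub E H v ≢ 1) where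

    fresh-edge-after : ∀ {v h w x is} (W : Walk E w x is) → All (v ≢_) (vertices E W) →
                       1 ≤ degSub E H v → ∃ λ j → j ∈ H × incident? v (lookup E j) ≡ true × j ∉ₗ h ∷ is
    fresh-edge-after {v} {h} W v∉W deg≥1 with other-incident-edge E v h (≤∧≢⇒< deg≥1 (≢-sym (no-leaf v)))
    ... | j , j≢h , j∈H , inc = j , j∈H , inc , λ
      { (here j≡h)   → j≢h j≡h
      ; (there j∈is) → All.lookup v∉W (endpoint∈vertices E W j∈is inc) refl
      }

    fresh-edge : ∀ {v x is} (W : Walk E v x is) → Unique (vertices E W) →
                 1 ≤ degSub E H v → ∃ λ j → j ∈ H × incident? v (lookup E j) ≡ true × j ∉ₗ is
    fresh-edge nil _ deg≥1 = let j , j∈H , inc = incident-edge E _ deg≥1 in j , j∈H , inc , λ ()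
    fresh-edge (fwd _ _ W) (v∉W ∷ _) = fresh-edge-after W v∉W
    fresh-edge (bwd _ _ W) (v∉W ∷ _) = fresh-edge-after W v∉W

    -- Without leaves, a path can always be prolonged at its start by a fresh edge (one leading
    -- back onto the path would close a cycle), which is impossible beyond n vertices.
    extend-path : ∀ f {v x is} (W : Walk E v x is) → Unique is → Unique (vertices E W) →
                  n < f + length (vertices E W) → 1 ≤ degSub E H v → ⊥
    extend-path zero    W _ uW n< _ = <⇒≱ n< (unique⇒length≤ uW)
    extend-path (suc f) {v} {is = is} W uis uW n< deg≥1 with fresh-edge W uW deg≥1
    ... | j , j∈H , inc , j∉is with incident⇒joins E j inc
    ...   | w , j-vw =
      extend-path f (step E j-wv W) ujis (subst Unique (sym (vertices-step E j-wv W)) uwW) n<′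
        (incident⇒degSub≥1 E j∈H (joins⇒incident E j-wv))
      where
      j-wv : Joins E j w v
      j-wv = joins-sym E j-vw
      ujis : Unique (j ∷ is)
      ujis = ¬Any⇒All¬ is j∉is ∷ uis
      uwW : Unique (w ∷ vertices E W)
      uwW = ¬Any⇒All¬ _ (neighbour-off-walk j-wv W ujis) ∷ uW
      n<′ : n < f + length (vertices E (step E j-wv W))
      n<′ rewrite vertices-step E j-wv W | +-suc f (length (vertices E W)) = n<

  leaf-exists : ∀ H {v} → 1 ≤ degSub E H v → ∃ λ a → degSub E H a ≡ 1
  leaf-exists H deg≥1 with any? (λ a → degSub E H a ≟ 1)
  ... | yes leaf = leaf
  ... | no ¬leaf = ⊥-elim (extend-path H (λ a deg≡1 → ¬leaf (a , deg≡1)) n nil [] ([] ∷ [])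
                                       (m<m+n n z<s) deg≥1)

-- Two matchings covering the branch vertices of a forest

module _ {n m} (E : Vec (Edge n) m) where

  IsMatching : Subset m → Set
  IsMatching M = ∀ v → degSub E M v ≤ 1

  branchCount : Subset m → ℕ
  branchCount H = length (filter (λ v → 2 ≤? degSub E H v) (allFin n))

  record MatchingPair (H : Subset m) : Set where
    field
      M₁ M₂          : Subset m
      M₁⊆H           : M₁ ⊆ H
      M₂⊆H           : M₂ ⊆ H
      M₁-matching    : IsMatching M₁
      M₂-matching    : IsMatching M₂
      free-at-leaves : ∀ v → degSub E H v ≤ 1 → degSub E M₁ v ≡ 0 ⊎ degSub E M₂ v ≡ 0
      branchCount≤   : branchCount H ≤ ∣ M₁ ∣ + ∣ M₂ ∣

  swap : ∀ {H} → MatchingPair H → MatchingPair H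
  swap {H} P = record
    { M₁ = M₂ ; M₂ = M₁ ; M₁⊆H = M₂⊆H ; M₂⊆H = M₁⊆H
    ; M₁-matching = M₂-matching ; M₂-matching = M₁-matching
    ; free-at-leaves = λ v → Sum.swap ∘ free-at-leaves v
    ; branchCount≤ = subst (branchCount H ≤_) (+-comm ∣ M₁ ∣ ∣ M₂ ∣) branchCount≤
    }
    where open MatchingPair P

  edgeless-pair : ∀ {H} → (∀ v → ¬ 1 ≤ degSub E H v) → MatchingPair H
  edgeless-pair {H} edgeless = record
    { M₁ = ∅ ; M₂ = ∅ ; M₁⊆H = ⊥⊆ ; M₂⊆H = ⊥⊆
    ; M₁-matching = ∅-matching ; M₂-matching = ∅-matching
    ; free-at-leaves = λ v _ → inj₁ (degSub-∅ E v)
    ; branchCount≤ = ≤-trans (≤-reflexive no-branch) z≤n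
    }
    where
    ∅-matching : IsMatching ∅
    ∅-matching v = ≤-trans (≤-reflexive (degSub-∅ E v)) z≤n

    no-branch : branchCount H ≡ 0
    no-branch = cong length (filter-none (λ v → 2 ≤? degSub E H v)
      (All.universal (λ v deg≥2 → edgeless v (≤-trans (s≤s z≤n) deg≥2)) (allFin n)))

  module PendantEdge {H j a b} (j∈H : j ∈ H) (j-ab : Joins E j a b) (leaf-a : degSub E H a ≡ 1) where

    H′ : Subset m
    H′ = H - j

    H′⊆H : H′ ⊆ H
    H′⊆H = p─q⊆p H ⁅ j ⁆

    deg-at-endpoint : ∀ {x} → incident? x (lookup E j) ≡ true → degSub E H x ≡ suc (degSub E H′ x)
    deg-at-endpoint {x} inc = trans (degSub-remove E j∈H x) (cong (_+ degSub E H′ x) (incidence-true inc))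

    deg-off-edge : ∀ {x} → incident? x (lookup E j) ≡ false → degSub E H x ≡ degSub E H′ x
    deg-off-edge {x} ¬inc = trans (degSub-remove E j∈H x) (cong (_+ degSub E H′ x) (incidence-false ¬inc))

    deg-a : degSub E H′ a ≡ 0
    deg-a = suc-injective (trans (sym (deg-at-endpoint (joins⇒incident E j-ab))) leaf-a)

    deg-b : degSub E H b ≡ suc (degSub E H′ b)
    deg-b = deg-at-endpoint (joins⇒incident E (joins-sym E j-ab))

    uncovered-at-a : ∀ {M} → M ⊆ H′ → degSub E M a ≡ 0
    uncovered-at-a M⊆H′ = n≤0⇒n≡0 (subst (_ ≤_) deg-a (degSub-mono E M⊆H′ a))

    branch-or-b : ∀ {v} → 2 ≤ degSub E H v → 2 ≤ degSub E H′ v ⊎ v ≡ b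
    branch-or-b {v} deg≥2 with joins-cases E j-ab v
    ... | inj₁ refl         = contradiction (subst (2 ≤_) leaf-a deg≥2) 1+n≰n
    ... | inj₂ (inj₁ refl)  = inj₂ refl
    ... | inj₂ (inj₂ ¬inc)  = inj₁ (subst (2 ≤_) (deg-off-edge ¬inc) deg≥2)

    branchCount≤suc : branchCount H ≤ suc (branchCount H′)
    branchCount≤suc = length-filter-≤-suc _ _ (allFin⁺ n) branch-or-b

    branchCount-mono : degSub E H′ b ≢ 1 → branchCount H ≤ branchCount H′
    branchCount-mono b-not-leaf = length-filter-mono _ _ (All.universal (λ _ → still-branch) (allFin n))
      where
      still-branch : ∀ {v} → 2 ≤ degSub E H v → 2 ≤ degSub E H′ v
      still-branch deg≥2 with branch-or-b deg≥2
      ... | inj₁ deg′≥2 = deg′≥2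
      ... | inj₂ refl   = ≤∧≢⇒< (≤-pred (subst (2 ≤_) deg-b deg≥2)) (≢-sym b-not-leaf)

    keep : degSub E H′ b ≢ 1 → MatchingPair H′ → MatchingPair H
    keep b-not-leaf P = record
      { M₁ = M₁ ; M₂ = M₂ ; M₁⊆H = ⊆-trans M₁⊆H H′⊆H ; M₂⊆H = ⊆-trans M₂⊆H H′⊆H
      ; M₁-matching = M₁-matching ; M₂-matching = M₂-matching
      ; free-at-leaves = λ v deg≤1 → free-at-leaves v (≤-trans (degSub-mono E H′⊆H v) deg≤1)
      ; branchCount≤ = ≤-trans (branchCount-mono b-not-leaf) branchCount≤
      }
      where open MatchingPair P

    extend : degSub E H′ b ≡ 1 → (P : MatchingPair H′) → degSub E (MatchingPair.M₁ P) b ≡ 0 →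
             MatchingPair H
    extend b-leaf P M₁-free-at-b = record
      { M₁ = M₁ ∪ ⁅ j ⁆ ; M₂ = M₂ ; M₁⊆H = M₁∪j⊆H ; M₂⊆H = ⊆-trans M₂⊆H H′⊆H
      ; M₁-matching = M₁∪j-matching ; M₂-matching = M₂-matching
      ; free-at-leaves = free-at-leaves′
      ; branchCount≤ = begin
          branchCount H               ≤⟨ branchCount≤suc ⟩
          suc (branchCount H′)        ≤⟨ s≤s branchCount≤ ⟩
          suc (∣ M₁ ∣ + ∣ M₂ ∣)       ≡⟨ cong (_+ ∣ M₂ ∣) (∣p∪⁅x⁆∣≡1+∣p∣ j∉M₁) ⟨
          ∣ M₁ ∪ ⁅ j ⁆ ∣ + ∣ M₂ ∣     ∎
      }
      where
      open MatchingPair P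
      open ≤-Reasoning

      j∉M₁ : j ∉ M₁
      j∉M₁ j∈M₁ = x∉p-x H j (M₁⊆H j∈M₁)

      M₁∪j⊆H : M₁ ∪ ⁅ j ⁆ ⊆ H
      M₁∪j⊆H x∈M₁∪j with x∈p∪q⁻ M₁ ⁅ j ⁆ x∈M₁∪j
      ... | inj₁ x∈M₁  = H′⊆H (M₁⊆H x∈M₁)
      ... | inj₂ x∈⁅j⁆ = subst (_∈ H) (sym (x∈⁅y⁆⇒x≡y j x∈⁅j⁆)) j∈H

      degSub-M₁∪j-off-edge : ∀ {x} → incident? x (lookup E j) ≡ false →
                             degSub E (M₁ ∪ ⁅ j ⁆) x ≡ degSub E M₁ x
      degSub-M₁∪j-off-edge {x} ¬inc =
        trans (degSub-∪⁅⁆ E j∉M₁ x) (cong (_+ degSub E M₁ x) (incidence-false ¬inc))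

      matching-at-free : ∀ x → degSub E M₁ x ≡ 0 → degSub E (M₁ ∪ ⁅ j ⁆) x ≤ 1
      matching-at-free x free = begin
        degSub E (M₁ ∪ ⁅ j ⁆) x                      ≡⟨ degSub-∪⁅⁆ E j∉M₁ x ⟩
        incidence x (lookup E j) + degSub E M₁ x     ≡⟨ cong (incidence x (lookup E j) +_) free ⟩
        incidence x (lookup E j) + 0                 ≡⟨ +-identityʳ _ ⟩
        incidence x (lookup E j)                     ≤⟨ incidence≤1 x (lookup E j) ⟩
        1                                            ∎

      M₁∪j-matching : IsMatching (M₁ ∪ ⁅ j ⁆)
      M₁∪j-matching x with joins-cases E j-ab x
      ... | inj₁ refl        = matching-at-free a (uncovered-at-a M₁⊆H)
      ... | inj₂ (inj₁ refl) = matching-at-free b M₁-free-at-b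
      ... | inj₂ (inj₂ ¬inc) = subst (_≤ 1) (sym (degSub-M₁∪j-off-edge ¬inc)) (M₁-matching x)

      free-at-leaves′ : ∀ x → degSub E H x ≤ 1 → degSub E (M₁ ∪ ⁅ j ⁆) x ≡ 0 ⊎ degSub E M₂ x ≡ 0
      free-at-leaves′ x deg≤1 with joins-cases E j-ab x
      ... | inj₁ refl        = inj₂ (uncovered-at-a M₂⊆H)
      ... | inj₂ (inj₁ refl) = contradiction (subst (_≤ 1) (trans deg-b (cong suc b-leaf)) deg≤1) 1+n≰n
      ... | inj₂ (inj₂ ¬inc) with free-at-leaves x (subst (_≤ 1) (deg-off-edge ¬inc) deg≤1)
      ...   | inj₁ M₁-free = inj₁ (trans (degSub-M₁∪j-off-edge ¬inc) M₁-free)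
      ...   | inj₂ M₂-free = inj₂ M₂-free

    add : MatchingPair H′ → MatchingPair H
    add P with degSub E H′ b ≟ 1
    ... | no b-not-leaf = keep b-not-leaf P
    ... | yes b-leaf with MatchingPair.free-at-leaves P b (≤-reflexive b-leaf)
    ...   | inj₁ M₁-free = extend b-leaf P M₁-free
    ...   | inj₂ M₂-free = extend b-leaf (swap P) M₂-free

matchingPair : ∀ {n m} {E : Vec (Edge n) m} → Acyclic E → ∀ H → MatchingPair E H
matchingPair {m = m} {E} acyclic H = bounded (suc m) H (s≤s (∣p∣≤n H))
  where
  bounded : ∀ k H → ∣ H ∣ < k → MatchingPair E H
  bounded (suc k) H ∣H∣<1+k with any? (λ v → 1 ≤? degSub E H v)
  ... | no ¬edge = edgeless-pair E (λ v deg≥1 → ¬edge (v , deg≥1))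
  ... | yes (_ , deg≥1) =
    let a , leaf-a    = leaf-exists acyclic H deg≥1
        j , j∈H , inc = incident-edge E a (≤-reflexive (sym leaf-a))
        b , j-ab      = incident⇒joins E j inc
    in PendantEdge.add E j∈H j-ab leaf-a
         (bounded k (H - j) (<-≤-trans (x∈p⇒∣p-x∣<∣p∣ j∈H) (≤-pred ∣H∣<1+k)))

-- Sub-matchings of T_L are fixed

2*≤ : ∀ {d D} → d ≤ 1 → (1 ≤ d → 2 ≤ D) → 2 * d ≤ D
2*≤ z≤n       _       = z≤n
2*≤ (s≤s z≤n) d≥1⇒D≥2 = d≥1⇒D≥2 ≤-refl

module _ {n m} (E : Vec (Edge n) m) where

  keepL-endpoints : ∀ {i} → i ∈ keepL E →
                    isLeaf? E (proj₁ (lookup E i)) ≡ false × isLeaf? E (proj₂ (lookup E i)) ≡ false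
  keepL-endpoints {i} i∈keepL with trans (sym (lookup-map i _ E)) ([]=⇒lookup i∈keepL)
  ... | kept with isLeaf? E (proj₁ (lookup E i)) | isLeaf? E (proj₂ (lookup E i))
  ...   | false | false = refl , refl
  ...   | true  | _     = case kept of λ ()
  ...   | false | true  = case kept of λ ()

  non-leaf⇒deg≢1 : ∀ {v} → isLeaf? E v ≡ false → deg E v ≢ 1
  non-leaf⇒deg≢1 {v} non-leaf with deg E v ≟ 1
  ... | yes _      = case non-leaf of λ ()
  ... | no deg≢1   = deg≢1

  keepL-vertex⇒deg≥2 : ∀ {v} → 1 ≤ degSub E (keepL E) v → 2 ≤ deg E v
  keepL-vertex⇒deg≥2 {v} deg≥1 with incident-edge E v deg≥1
  ... | i , i∈keepL , inc =
    ≤∧≢⇒< (≤-trans deg≥1 (degSub-mono E ⊆⊤ v)) (≢-sym (non-leaf⇒deg≢1 v-non-leaf))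
    where
    v-non-leaf : isLeaf? E v ≡ false
    v-non-leaf with incident⇒endpoint (lookup E i) inc
    ... | inj₁ refl = proj₁ (keepL-endpoints i∈keepL)
    ... | inj₂ refl = proj₂ (keepL-endpoints i∈keepL)

  ⊆-matching⇒fix : ∀ {M S} → M ⊆ keepL E → IsMatching E M → S ⊆ M → IsFix E S
  ⊆-matching⇒fix M⊆keepL M-matching S⊆M v =
    2*≤ (≤-trans (degSub-mono E S⊆M v) (M-matching v))
        (λ deg≥1 → keepL-vertex⇒deg≥2 (≤-trans deg≥1 (degSub-mono E (⊆-trans S⊆M M⊆keepL) v)))

  2^∣matching∣≤numFix : ∀ {M} → M ⊆ keepL E → IsMatching E M → 2 ^ ∣ M ∣ ≤ numFix E
  2^∣matching∣≤numFix {M} M⊆keepL M-matching = subsets-count (isFix? E) M (⊆-matching⇒fix M⊆keepL M-matching)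

lemma10 : ∀ (n m : ℕ) (E : Vec (Edge n) m) → IsTree E →
    2 ^ innerCount E ≤ numFix E * numFix E
lemma10 n m E T = begin
  2 ^ innerCount E          ≤⟨ ^-monoʳ-≤ 2 (≤-trans innerCount≤branchCount branchCount≤) ⟩
  2 ^ (∣ M₁ ∣ + ∣ M₂ ∣)     ≡⟨ ^-distribˡ-+-* 2 ∣ M₁ ∣ ∣ M₂ ∣ ⟩
  2 ^ ∣ M₁ ∣ * 2 ^ ∣ M₂ ∣   ≤⟨ *-mono-≤ (2^∣matching∣≤numFix E M₁⊆H M₁-matching)
                                        (2^∣matching∣≤numFix E M₂⊆H M₂-matching) ⟩
  numFix E * numFix E       ∎
  where
  open ≤-Reasoning
  open MatchingPair (matchingPair (IsTree.acyclic T) (keepL E))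

  innerCount≤branchCount : innerCount E ≤ branchCount E (keepL E)
  innerCount≤branchCount = length-filter-mono (innerL? E) _ (All.universal (λ _ → proj₂) (allFin n))
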